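{- For $n\ge1$ write the $n$-th power of the differential operator $(x+x^2)D$ (where $D=d/dx$) acting on polynomials as $$((x+x^2)D)^n=\sum_{k=1}^nG_{n,k}(x)\,(x+x^2)^kD^k,$$ with polynomial coefficients $G_{n,k}(x)$, and write $G_{n,1}(x)=\sum_{k=1}^nG(n,k)x^{k-1}$. Then for $1\le k\le n$, $$G(n,k)=k!\,S(n,k),$$ where $S(n,k)$ is the Stirling number of the second kind.
   Context: $S(n,k)$ is the number of partitions of an $n$-element set into $k$ nonempty blocks; equivalently $S(0,0)=1$, $S(n,0)=0$ for $n\ge1$ and $S(n+1,k)=kS(n,k)+S(n,k-1)$. -}

module Defs where

open import Data.Nat using (ℕ; zero; suc; _∸_; _≤_; _!) renaming (_*_ to _*ℕ_; _+_ to _+ℕ_)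
open import Data.Integer using (ℤ; +_) renaming (_+_ to _+ℤ_; _*_ to _*ℤ_)
open import Data.List using (List; []; _∷_; map)
open import Relation.Binary.PropositionalEquality using (_≡_)

-- Polynomials with integer coefficients in one variable x,
-- as coefficient lists: the i-th entry is the coefficient of x^i.
Poly : Set
Poly = List ℤ

coeff : Poly → ℕ → ℤ
coeff []      _       = + 0
coeff (a ∷ p) zero    = a
coeff (a ∷ p) (suc i) = coeff p i

-- equality of polynomials (coefficientwise; ignores trailing zeros)
infix 4 _≈P_
_≈P_ : Poly → Poly → Set
p ≈P q = ∀ i → coeff p i ≡ coeff q i

infixl 6 _+P_
_+P_ : Poly → Poly → Poly
[]      +P q       = q
(a ∷ p) +P []      = a ∷ p
(a ∷ p) +P (b ∷ q) = (a +ℤ b) ∷ (p +P q)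

infixl 7 _*P_
_*P_ : Poly → Poly → Poly
[]      *P q = []
(a ∷ p) *P q = map (a *ℤ_) q +P (+ 0 ∷ (p *P q))

_^P_ : Poly → ℕ → Poly
p ^P zero  = + 1 ∷ []
p ^P suc n = p *P (p ^P n)

derivAux : ℕ → Poly → Poly
derivAux i []      = []
derivAux i (a ∷ p) = ((+ i) *ℤ a) ∷ derivAux (suc i) p

D : Poly → Poly
D []      = []
D (a ∷ p) = derivAux 1 p

xx² : Poly
xx² = + 0 ∷ + 1 ∷ + 1 ∷ []

iter : (Poly → Poly) → ℕ → Poly → Poly
iter f zero    p = p
iter f (suc n) p = f (iter f n p)

θ : Poly → Poly
θ p = xx² *P D p

Σ₁ : ℕ → (ℕ → Poly) → Poly
Σ₁ zero    f = []
Σ₁ (suc n) f = Σ₁ n f +P f (suc n)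

IsExpansion : (ℕ → ℕ → Poly) → Set
IsExpansion G = ∀ n → 1 ≤ n → ∀ (p : Poly) →
  iter θ n p ≈P Σ₁ n (λ k → G n k *P (xx² ^P k) *P iter D k p)

S : ℕ → ℕ → ℕ
S zero    zero    = 1
S zero    (suc k) = 0
S (suc n) zero    = 0
S (suc n) (suc k) = (suc k) *ℕ S n (suc k) +ℕ S n k

module Submission where

-- Polynomials (coefficient lists up to coefficientwise
-- equality) form a commutative ring on which D is a derivation, hence so
-- is θ = w·D with w = x + x².  From θ(w^k) = k·w′·w^k one gets, for every
-- polynomial g and every E,
--     θ(g·w^k·E) = (θ g + k·w′·g)·w^k·E + g·w^(k+1)·D E,
-- so θ maps an expression Σ_k g_k·w^k·D^k p to one of the same shape with
-- coefficients  g'_k = θ g_k + k·w′·g_k + g_(k-1).  Iterating from θ = 1·w·D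
-- produces the coefficients G_(n,k) and the expansion of θ^n.
--
-- For an arbitrary expansion G apply both sides to p = x: all
-- terms with k ≥ 2 vanish, so θ^n x = w·G_(n,1).  Since w is not a zero
-- divisor this gives G_(1,1) = 1 and G_(n+1,1) = D(w·G_(n,1)), i.e. on
-- coefficients  G(n+1,k+1) = (k+1)(G(n,k+1) + G(n,k)).  The numbers
-- k!·S(n,k) of surjections obey the same recurrence, which proves the claim.

open import Defs
open import Data.Nat using (ℕ; _∸_; _≤_; _*_; _!)
open import Data.Integer using (+_)
open import Data.Product using (_×_; ∃)
open import Relation.Binary.PropositionalEquality using (_≡_)

open import Level using (0ℓ)
open import Data.Nat using (zero; suc; _<_; s≤s; z≤n) renaming (_+_ to _+ℕ_)
import Data.Nat.Properties as ℕP
import Data.Nat.Tactic.RingSolver as ℕSolver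
open import Data.Integer using (ℤ; -_) renaming (_+_ to _+ℤ_; _*_ to _*ℤ_)
import Data.Integer.Properties as ℤP
import Data.Integer.Tactic.RingSolver as ℤSolver
open import Data.List using ([]; _∷_; map)
open import Data.Product using (_,_)
open import Relation.Binary.PropositionalEquality
  using (refl; sym; trans; cong; cong₂; module ≡-Reasoning)
open import Relation.Binary.Bundles using (Setoid)
open import Relation.Binary.Structures using (IsEquivalence)
open import Algebra.Bundles using (CommutativeRing)
open import Algebra.Properties.AbelianGroup ℤP.+-0-abelianGroup using (∙-cancelʳ)
open import Tactic.RingSolver.Core.AlmostCommutativeRing using (fromCommutativeRing)
open import Data.Maybe using (nothing)
import Tactic.RingSolver.NonReflective as NonReflectiveSolver
import Relation.Binary.Reasoning.Setoid as SetoidReasoning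

coeff-+ : ∀ p q i → coeff (p +P q) i ≡ coeff p i +ℤ coeff q i
coeff-+ []      q       i       = sym (ℤP.+-identityˡ _)
coeff-+ (a ∷ p) []      i       = sym (ℤP.+-identityʳ _)
coeff-+ (a ∷ p) (b ∷ q) zero    = refl
coeff-+ (a ∷ p) (b ∷ q) (suc i) = coeff-+ p q i

scale : ℤ → Poly → Poly
scale a = map (a *ℤ_)

coeff-scale : ∀ a q i → coeff (scale a q) i ≡ a *ℤ coeff q i
coeff-scale a []      i       = sym (ℤP.*-zeroʳ a)
coeff-scale a (b ∷ q) zero    = refl
coeff-scale a (b ∷ q) (suc i) = coeff-scale a q i

-P_ : Poly → Poly
-P_ = map -_

coeff-neg : ∀ q i → coeff (-P q) i ≡ - coeff q i
coeff-neg []      i       = refl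
coeff-neg (b ∷ q) zero    = refl
coeff-neg (b ∷ q) (suc i) = coeff-neg q i

conv : (ℕ → ℤ) → (ℕ → ℤ) → ℕ → ℤ
conv f g zero    = f 0 *ℤ g 0
conv f g (suc i) = f 0 *ℤ g (suc i) +ℤ conv (λ j → f (suc j)) g i

conv-zeroˡ : ∀ g i → conv (λ _ → + 0) g i ≡ + 0
conv-zeroˡ g zero    = refl
conv-zeroˡ g (suc i) = trans (ℤP.+-identityˡ _) (conv-zeroˡ g i)

conv-cong : ∀ {f f′ g g′} → (∀ j → f j ≡ f′ j) → (∀ j → g j ≡ g′ j) →
            ∀ i → conv f g i ≡ conv f′ g′ i
conv-cong ef eg zero    = cong₂ _*ℤ_ (ef 0) (eg 0)
conv-cong ef eg (suc i) =
  cong₂ _+ℤ_ (cong₂ _*ℤ_ (ef 0) (eg (suc i))) (conv-cong (λ j → ef (suc j)) eg i)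

conv-+ˡ : ∀ f f′ g i → conv (λ j → f j +ℤ f′ j) g i ≡ conv f g i +ℤ conv f′ g i
conv-+ˡ f f′ g zero    = ℤP.*-distribʳ-+ (g 0) (f 0) (f′ 0)
conv-+ˡ f f′ g (suc i) =
  trans (cong₂ _+ℤ_ (ℤP.*-distribʳ-+ (g (suc i)) (f 0) (f′ 0))
                    (conv-+ˡ (λ j → f (suc j)) (λ j → f′ (suc j)) g i))
        (interchange (f 0 *ℤ g (suc i)) (f′ 0 *ℤ g (suc i))
                     (conv (λ j → f (suc j)) g i) (conv (λ j → f′ (suc j)) g i))
  where interchange : ∀ a b c d → (a +ℤ b) +ℤ (c +ℤ d) ≡ (a +ℤ c) +ℤ (b +ℤ d)
        interchange = ℤSolver.solve-∀

conv-scaleˡ : ∀ a f g i → conv (λ j → a *ℤ f j) g i ≡ a *ℤ conv f g i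
conv-scaleˡ a f g zero    = ℤP.*-assoc a (f 0) (g 0)
conv-scaleˡ a f g (suc i) =
  trans (cong₂ _+ℤ_ (ℤP.*-assoc a (f 0) (g (suc i))) (conv-scaleˡ a (λ j → f (suc j)) g i))
        (sym (ℤP.*-distribˡ-+ a _ _))

cons : ℤ → (ℕ → ℤ) → ℕ → ℤ
cons a h zero    = a
cons a h (suc i) = h i

shift : (ℕ → ℤ) → ℕ → ℤ
shift = cons (+ 0)

-- Convolving with a, h 0, h 1, … is  a·g + x·(g ⋆ h).  This is what makes
-- multiplication commutative.
conv-cons : ∀ g a h i → conv g (cons a h) i ≡ a *ℤ g i +ℤ shift (conv g h) i
conv-cons g a h zero          = trans (ℤP.*-comm (g 0) a) (sym (ℤP.+-identityʳ _))
conv-cons g a h (suc zero)    =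
  trans (cong (g 0 *ℤ h 0 +ℤ_) (conv-cons (λ j → g (suc j)) a h zero))
        (swap (g 0 *ℤ h 0) (a *ℤ g 1))
  where swap : ∀ u v → u +ℤ (v +ℤ + 0) ≡ v +ℤ u
        swap = ℤSolver.solve-∀
conv-cons g a h (suc (suc i)) =
  trans (cong (g 0 *ℤ h (suc i) +ℤ_) (conv-cons (λ j → g (suc j)) a h (suc i)))
        (swap (g 0 *ℤ h (suc i)) (a *ℤ g (suc (suc i))) (conv (λ j → g (suc j)) h i))
  where swap : ∀ u v w → u +ℤ (v +ℤ w) ≡ v +ℤ (u +ℤ w)
        swap = ℤSolver.solve-∀

coeff-* : ∀ p q i → coeff (p *P q) i ≡ conv (coeff p) (coeff q) i
coeff-* []      q i       = sym (conv-zeroˡ (coeff q) i)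
coeff-* (a ∷ p) q zero    =
  trans (coeff-+ (scale a q) (+ 0 ∷ (p *P q)) zero)
        (trans (ℤP.+-identityʳ _) (coeff-scale a q zero))
coeff-* (a ∷ p) q (suc i) =
  trans (coeff-+ (scale a q) (+ 0 ∷ (p *P q)) (suc i))
        (cong₂ _+ℤ_ (coeff-scale a q (suc i)) (coeff-* p q i))

-- Coefficientwise equality, wrapped in a record so that both polynomials
-- can be recovered from the type of a proof.
infix 4 _≋_
record _≋_ (p q : Poly) : Set where
  constructor mk
  field get : p ≈P q
open _≋_ public

≋-refl : ∀ {p} → p ≋ p
≋-refl = mk λ i → refl

≋-sym : ∀ {p q} → p ≋ q → q ≋ p
≋-sym (mk e) = mk λ i → sym (e i)

≋-trans : ∀ {p q r} → p ≋ q → q ≋ r → p ≋ r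
≋-trans (mk e) (mk f) = mk λ i → trans (e i) (f i)

≋-isEquivalence : IsEquivalence _≋_
≋-isEquivalence = record { refl = ≋-refl ; sym = ≋-sym ; trans = ≋-trans }

≋-setoid : Setoid 0ℓ 0ℓ
≋-setoid = record { isEquivalence = ≋-isEquivalence }

∷-cong : ∀ a {p q} → p ≋ q → (a ∷ p) ≋ (a ∷ q)
∷-cong a (mk e) = mk λ { zero → refl ; (suc i) → e i }

+P-cong : ∀ {p p′ q q′} → p ≋ p′ → q ≋ q′ → (p +P q) ≋ (p′ +P q′)
+P-cong {p} {p′} {q} {q′} (mk e) (mk f) = mk λ i →
  trans (coeff-+ p q i) (trans (cong₂ _+ℤ_ (e i) (f i)) (sym (coeff-+ p′ q′ i)))

*P-cong : ∀ {p p′ q q′} → p ≋ p′ → q ≋ q′ → (p *P q) ≋ (p′ *P q′)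
*P-cong {p} {p′} {q} {q′} (mk e) (mk f) = mk λ i →
  trans (coeff-* p q i) (trans (conv-cong e f i) (sym (coeff-* p′ q′ i)))

-P-cong : ∀ {p p′} → p ≋ p′ → (-P p) ≋ (-P p′)
-P-cong {p} {p′} (mk e) = mk λ i →
  trans (coeff-neg p i) (trans (cong -_ (e i)) (sym (coeff-neg p′ i)))

+P-assoc : ∀ p q r → ((p +P q) +P r) ≋ (p +P (q +P r))
+P-assoc p q r = mk λ i → begin
  coeff ((p +P q) +P r) i                 ≡⟨ coeff-+ (p +P q) r i ⟩
  coeff (p +P q) i +ℤ coeff r i           ≡⟨ cong (_+ℤ coeff r i) (coeff-+ p q i) ⟩
  coeff p i +ℤ coeff q i +ℤ coeff r i     ≡⟨ ℤP.+-assoc (coeff p i) (coeff q i) (coeff r i) ⟩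
  coeff p i +ℤ (coeff q i +ℤ coeff r i)   ≡⟨ cong (coeff p i +ℤ_) (coeff-+ q r i) ⟨
  coeff p i +ℤ coeff (q +P r) i           ≡⟨ coeff-+ p (q +P r) i ⟨
  coeff (p +P (q +P r)) i                 ∎
  where open ≡-Reasoning

+P-comm : ∀ p q → (p +P q) ≋ (q +P p)
+P-comm p q = mk λ i →
  trans (coeff-+ p q i) (trans (ℤP.+-comm (coeff p i) (coeff q i)) (sym (coeff-+ q p i)))

+P-identityʳ : ∀ p → (p +P []) ≋ p
+P-identityʳ p = mk λ i → trans (coeff-+ p [] i) (ℤP.+-identityʳ _)

+P-inverseˡ : ∀ p → ((-P p) +P p) ≋ []
+P-inverseˡ p = mk λ i →
  trans (coeff-+ (-P p) p i) (trans (cong (_+ℤ coeff p i) (coeff-neg p i)) (ℤP.+-inverseˡ (coeff p i)))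

*P-distribʳ : ∀ r p q → ((p +P q) *P r) ≋ ((p *P r) +P (q *P r))
*P-distribʳ r p q = mk λ i → begin
  coeff ((p +P q) *P r) i                          ≡⟨ coeff-* (p +P q) r i ⟩
  conv (coeff (p +P q)) (coeff r) i                ≡⟨ conv-cong (coeff-+ p q) (λ j → refl) i ⟩
  conv (λ j → coeff p j +ℤ coeff q j) (coeff r) i  ≡⟨ conv-+ˡ (coeff p) (coeff q) (coeff r) i ⟩
  conv (coeff p) (coeff r) i +ℤ conv (coeff q) (coeff r) i
                                                   ≡⟨ cong₂ _+ℤ_ (coeff-* p r i) (coeff-* q r i) ⟨
  coeff (p *P r) i +ℤ coeff (q *P r) i             ≡⟨ coeff-+ (p *P r) (q *P r) i ⟨
  coeff ((p *P r) +P (q *P r)) i                   ∎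
  where open ≡-Reasoning

scale-*P : ∀ a q r → (scale a q *P r) ≋ scale a (q *P r)
scale-*P a q r = mk λ i → begin
  coeff (scale a q *P r) i                     ≡⟨ coeff-* (scale a q) r i ⟩
  conv (coeff (scale a q)) (coeff r) i         ≡⟨ conv-cong (coeff-scale a q) (λ j → refl) i ⟩
  conv (λ j → a *ℤ coeff q j) (coeff r) i      ≡⟨ conv-scaleˡ a (coeff q) (coeff r) i ⟩
  a *ℤ conv (coeff q) (coeff r) i              ≡⟨ cong (a *ℤ_) (coeff-* q r i) ⟨
  a *ℤ coeff (q *P r) i                        ≡⟨ coeff-scale a (q *P r) i ⟨
  coeff (scale a (q *P r)) i                   ∎
  where open ≡-Reasoning

shift-*P : ∀ s r → ((+ 0 ∷ s) *P r) ≋ (+ 0 ∷ (s *P r))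
shift-*P s r = mk λ
  { zero    → coeff-* (+ 0 ∷ s) r zero
  ; (suc i) → trans (coeff-* (+ 0 ∷ s) r (suc i)) (trans (ℤP.+-identityˡ _) (sym (coeff-* s r i))) }

*P-assoc : ∀ p q r → ((p *P q) *P r) ≋ (p *P (q *P r))
*P-assoc []      q r = ≋-refl
*P-assoc (a ∷ p) q r =
  ≋-trans (*P-distribʳ r (scale a q) (+ 0 ∷ (p *P q)))
          (+P-cong (scale-*P a q r) (≋-trans (shift-*P (p *P q) r) (∷-cong (+ 0) (*P-assoc p q r))))

*P-zeroʳ : ∀ q → (q *P []) ≋ []
*P-zeroʳ []      = ≋-refl
*P-zeroʳ (b ∷ q) = mk λ { zero → refl ; (suc i) → get (*P-zeroʳ q) i }

*P-cons : ∀ q a p → (q *P (a ∷ p)) ≋ (scale a q +P (+ 0 ∷ (q *P p)))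
*P-cons q a p = mk λ i → begin
  coeff (q *P (a ∷ p)) i                             ≡⟨ coeff-* q (a ∷ p) i ⟩
  conv (coeff q) (coeff (a ∷ p)) i                   ≡⟨ conv-cong (λ j → refl) coeff-∷ i ⟩
  conv (coeff q) (cons a (coeff p)) i                ≡⟨ conv-cons (coeff q) a (coeff p) i ⟩
  a *ℤ coeff q i +ℤ shift (conv (coeff q) (coeff p)) i
                                   ≡⟨ cong₂ _+ℤ_ (coeff-scale a q i) (coeff-shifted i) ⟨
  coeff (scale a q) i +ℤ coeff (+ 0 ∷ (q *P p)) i    ≡⟨ coeff-+ (scale a q) (+ 0 ∷ (q *P p)) i ⟨
  coeff (scale a q +P (+ 0 ∷ (q *P p))) i            ∎
  where
    open ≡-Reasoning
    coeff-∷ : ∀ j → coeff (a ∷ p) j ≡ cons a (coeff p) j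
    coeff-∷ zero    = refl
    coeff-∷ (suc j) = refl
    coeff-shifted : ∀ i → coeff (+ 0 ∷ (q *P p)) i ≡ shift (conv (coeff q) (coeff p)) i
    coeff-shifted zero    = refl
    coeff-shifted (suc i) = coeff-* q p i

*P-comm : ∀ p q → (p *P q) ≋ (q *P p)
*P-comm []      q = ≋-sym (*P-zeroʳ q)
*P-comm (a ∷ p) q = ≋-trans (+P-cong ≋-refl (∷-cong (+ 0) (*P-comm p q))) (≋-sym (*P-cons q a p))

1P : Poly
1P = + 1 ∷ []

*P-identityˡ : ∀ q → (1P *P q) ≋ q
*P-identityˡ q = mk λ i →
  trans (coeff-+ (scale (+ 1) q) (+ 0 ∷ []) i)
        (trans (cong₂ _+ℤ_ (coeff-scale (+ 1) q i) (zero-coeffs i))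
               (trans (ℤP.+-identityʳ _) (ℤP.*-identityˡ _)))
  where zero-coeffs : ∀ i → coeff (+ 0 ∷ []) i ≡ + 0
        zero-coeffs zero    = refl
        zero-coeffs (suc i) = refl

polyRing : CommutativeRing 0ℓ 0ℓ
polyRing = record
  { Carrier = Poly ; _≈_ = _≋_ ; _+_ = _+P_ ; _*_ = _*P_ ; -_ = -P_ ; 0# = [] ; 1# = 1P
  ; isCommutativeRing = record
    { isRing = record
      { +-isAbelianGroup = record
        { isGroup = record
          { isMonoid = record
            { isSemigroup = record
              { isMagma = record { isEquivalence = ≋-isEquivalence ; ∙-cong = +P-cong }
              ; assoc = +P-assoc }
            ; identity = (λ p → ≋-refl) , +P-identityʳ }
          ; inverse = +P-inverseˡ , (λ p → ≋-trans (+P-comm p (-P p)) (+P-inverseˡ p))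
          ; ⁻¹-cong = -P-cong }
        ; comm = +P-comm }
      ; *-cong = *P-cong
      ; *-assoc = *P-assoc
      ; *-identity = *P-identityˡ , (λ q → ≋-trans (*P-comm q 1P) (*P-identityˡ q))
      ; distrib = (λ r p q → ≋-trans (*P-comm r (p +P q))
                               (≋-trans (*P-distribʳ r p q) (+P-cong (*P-comm p r) (*P-comm q r))))
                , *P-distribʳ }
    ; *-comm = *P-comm } }

module PolySolver = NonReflectiveSolver (fromCommutativeRing polyRing (λ _ → nothing))
open PolySolver using (solve; _⊜_; _⊕_; _⊗_; Κ)
module ≋-Reasoning = SetoidReasoning ≋-setoid

constP : ℤ → Poly
constP a = a ∷ []

constP-zero : constP (+ 0) ≋ []
constP-zero = mk λ { zero → refl ; (suc i) → refl }

constP-suc : ∀ k → constP (+ suc k) ≋ (1P +P constP (+ k))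
constP-suc k = mk λ { zero → sym (ℤP.pos-+ 1 k) ; (suc i) → refl }

xP : Poly
xP = + 0 ∷ + 1 ∷ []

scale-zero : ∀ q → scale (+ 0) q ≋ []
scale-zero q = mk λ i → coeff-scale (+ 0) q i

scale-one : ∀ q → scale (+ 1) q ≋ q
scale-one q = mk λ i → trans (coeff-scale (+ 1) q i) (ℤP.*-identityˡ _)

scale-constP : ∀ a q → scale a q ≋ (constP a *P q)
scale-constP a q = ≋-sym (≋-trans (+P-cong (≋-refl {scale a q}) constP-zero) (+P-identityʳ (scale a q)))

x*P : ∀ r → (xP *P r) ≋ (+ 0 ∷ r)
x*P r = +P-cong (scale-zero r) (∷-cong (+ 0) (*P-identityˡ r))

∷-as-sum : ∀ a p → (a ∷ p) ≋ (constP a +P (xP *P p))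
∷-as-sum a p = ≋-trans (mk λ { zero → sym (ℤP.+-identityʳ a) ; (suc i) → refl })
                        (+P-cong (≋-refl {constP a}) (≋-sym (x*P p)))

coeff-derivAux : ∀ m p i → coeff (derivAux m p) i ≡ + (m +ℕ i) *ℤ coeff p i
coeff-derivAux m []      i       = sym (ℤP.*-zeroʳ (+ (m +ℕ i)))
coeff-derivAux m (a ∷ p) zero    = cong (λ z → + z *ℤ a) (sym (ℕP.+-identityʳ m))
coeff-derivAux m (a ∷ p) (suc i) =
  trans (coeff-derivAux (suc m) p i) (cong (λ z → + z *ℤ coeff p i) (sym (ℕP.+-suc m i)))

coeff-D : ∀ p i → coeff (D p) i ≡ + suc i *ℤ coeff p (suc i)
coeff-D []      i = sym (ℤP.*-zeroʳ (+ suc i))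
coeff-D (a ∷ p) i = coeff-derivAux 1 p i

D-cong : ∀ {p q} → p ≋ q → D p ≋ D q
D-cong {p} {q} (mk e) = mk λ i →
  trans (coeff-D p i) (trans (cong (+ suc i *ℤ_) (e (suc i))) (sym (coeff-D q i)))

D-+ : ∀ p q → D (p +P q) ≋ (D p +P D q)
D-+ p q = mk λ i → begin
  coeff (D (p +P q)) i                                          ≡⟨ coeff-D (p +P q) i ⟩
  + suc i *ℤ coeff (p +P q) (suc i)                             ≡⟨ cong (+ suc i *ℤ_) (coeff-+ p q (suc i)) ⟩
  + suc i *ℤ (coeff p (suc i) +ℤ coeff q (suc i))               ≡⟨ ℤP.*-distribˡ-+ (+ suc i) (coeff p (suc i)) (coeff q (suc i)) ⟩
  + suc i *ℤ coeff p (suc i) +ℤ + suc i *ℤ coeff q (suc i)     ≡⟨ cong₂ _+ℤ_ (coeff-D p i) (coeff-D q i) ⟨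
  coeff (D p) i +ℤ coeff (D q) i                                ≡⟨ coeff-+ (D p) (D q) i ⟨
  coeff (D p +P D q) i                                          ∎
  where open ≡-Reasoning

D-scale : ∀ a q → D (scale a q) ≋ scale a (D q)
D-scale a q = mk λ i → begin
  coeff (D (scale a q)) i                 ≡⟨ coeff-D (scale a q) i ⟩
  + suc i *ℤ coeff (scale a q) (suc i)    ≡⟨ cong (+ suc i *ℤ_) (coeff-scale a q (suc i)) ⟩
  + suc i *ℤ (a *ℤ coeff q (suc i))       ≡⟨ swap (+ suc i) a (coeff q (suc i)) ⟩
  a *ℤ (+ suc i *ℤ coeff q (suc i))       ≡⟨ cong (a *ℤ_) (coeff-D q i) ⟨
  a *ℤ coeff (D q) i                      ≡⟨ coeff-scale a (D q) i ⟨
  coeff (scale a (D q)) i                 ∎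
  where
    open ≡-Reasoning
    swap : ∀ u v w → u *ℤ (v *ℤ w) ≡ v *ℤ (u *ℤ w)
    swap = ℤSolver.solve-∀

-- D(a + x·p) = p + x·D p : the case of the Leibniz rule for the factor x.
D-∷ : ∀ a p → D (a ∷ p) ≋ (p +P (xP *P D p))
D-∷ a p = ≋-trans (mk coeffs) (+P-cong (≋-refl {p}) (≋-sym (x*P (D p))))
  where
    open ≡-Reasoning
    coeffs : ∀ i → coeff (D (a ∷ p)) i ≡ coeff (p +P (+ 0 ∷ D p)) i
    coeffs zero    = begin
      coeff (D (a ∷ p)) 0               ≡⟨ coeff-D (a ∷ p) 0 ⟩
      + 1 *ℤ coeff p 0                  ≡⟨ ℤP.*-identityˡ _ ⟩
      coeff p 0                         ≡⟨ ℤP.+-identityʳ _ ⟨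
      coeff p 0 +ℤ + 0                  ≡⟨ coeff-+ p (+ 0 ∷ D p) 0 ⟨
      coeff (p +P (+ 0 ∷ D p)) 0        ∎
    coeffs (suc i) = begin
      coeff (D (a ∷ p)) (suc i)                          ≡⟨ coeff-D (a ∷ p) (suc i) ⟩
      + suc (suc i) *ℤ coeff p (suc i)                   ≡⟨ cong (_*ℤ coeff p (suc i)) (ℤP.pos-+ 1 (suc i)) ⟩
      (+ 1 +ℤ + suc i) *ℤ coeff p (suc i)                ≡⟨ ℤP.*-distribʳ-+ (coeff p (suc i)) (+ 1) (+ suc i) ⟩
      + 1 *ℤ coeff p (suc i) +ℤ + suc i *ℤ coeff p (suc i)
                                                         ≡⟨ cong₂ _+ℤ_ (ℤP.*-identityˡ (coeff p (suc i))) (sym (coeff-D p i)) ⟩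
      coeff p (suc i) +ℤ coeff (D p) i                   ≡⟨ coeff-+ p (+ 0 ∷ D p) (suc i) ⟨
      coeff (p +P (+ 0 ∷ D p)) (suc i)                   ∎

leibniz : ∀ p q → D (p *P q) ≋ ((D p *P q) +P (p *P D q))
leibniz []      q = ≋-refl
leibniz (a ∷ p) q = begin
  D (scale a q +P (+ 0 ∷ (p *P q)))
    ≈⟨ D-+ (scale a q) (+ 0 ∷ (p *P q)) ⟩
  D (scale a q) +P D (+ 0 ∷ (p *P q))
    ≈⟨ +P-cong (≋-trans (D-scale a q) (scale-constP a (D q))) (D-∷ (+ 0) (p *P q)) ⟩
  (constP a *P D q) +P ((p *P q) +P (xP *P D (p *P q)))
    ≈⟨ +P-cong (≋-refl {constP a *P D q}) (+P-cong (≋-refl {p *P q}) (*P-cong (≋-refl {xP}) (leibniz p q))) ⟩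
  (constP a *P D q) +P ((p *P q) +P (xP *P ((D p *P q) +P (p *P D q))))
    ≈⟨ solve 6 (λ c x p′ q′ dp dq → (c ⊗ dq ⊕ (p′ ⊗ q′ ⊕ x ⊗ (dp ⊗ q′ ⊕ p′ ⊗ dq)))
                                    ⊜ ((p′ ⊕ x ⊗ dp) ⊗ q′ ⊕ (c ⊕ x ⊗ p′) ⊗ dq))
             ≋-refl (constP a) xP p q (D p) (D q) ⟩
  ((p +P (xP *P D p)) *P q) +P ((constP a +P (xP *P p)) *P D q)
    ≈⟨ +P-cong (*P-cong (≋-sym (D-∷ a p)) ≋-refl) (*P-cong (≋-sym (∷-as-sum a p)) ≋-refl) ⟩
  (D (a ∷ p) *P q) +P ((a ∷ p) *P D q) ∎
  where open ≋-Reasoning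

θ-cong : ∀ {p q} → p ≋ q → θ p ≋ θ q
θ-cong e = *P-cong (≋-refl {xx²}) (D-cong e)

θ-+ : ∀ p q → θ (p +P q) ≋ (θ p +P θ q)
θ-+ p q = ≋-trans (*P-cong (≋-refl {xx²}) (D-+ p q))
                  (solve 3 (λ w a b → (w ⊗ (a ⊕ b)) ⊜ (w ⊗ a ⊕ w ⊗ b)) ≋-refl xx² (D p) (D q))

θ-leibniz : ∀ p q → θ (p *P q) ≋ ((θ p *P q) +P (p *P θ q))
θ-leibniz p q = ≋-trans (*P-cong (≋-refl {xx²}) (leibniz p q))
  (solve 5 (λ w p′ q′ dp dq → (w ⊗ (dp ⊗ q′ ⊕ p′ ⊗ dq)) ⊜ ((w ⊗ dp) ⊗ q′ ⊕ p′ ⊗ (w ⊗ dq)))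
         ≋-refl xx² p q (D p) (D q))

w′ : Poly
w′ = D xx²

θ-power : ∀ k → θ (xx² ^P k) ≋ (constP (+ k) *P (w′ *P (xx² ^P k)))
θ-power zero    = ≋-trans (*P-zeroʳ xx²) (≋-sym (*P-cong constP-zero (≋-refl {w′ *P 1P})))
θ-power (suc k) = begin
  θ (xx² *P wᵏ)                                          ≈⟨ θ-leibniz xx² wᵏ ⟩
  (θ xx² *P wᵏ) +P (xx² *P θ wᵏ)                         ≈⟨ +P-cong (≋-refl {θ xx² *P wᵏ}) (*P-cong (≋-refl {xx²}) (θ-power k)) ⟩
  (θ xx² *P wᵏ) +P (xx² *P (constP (+ k) *P (w′ *P wᵏ)))
    ≈⟨ solve 4 (λ w w₁ y c → ((w ⊗ w₁) ⊗ y ⊕ w ⊗ (c ⊗ (w₁ ⊗ y))) ⊜ ((Κ 1P ⊕ c) ⊗ (w₁ ⊗ (w ⊗ y))))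
             ≋-refl xx² w′ wᵏ (constP (+ k)) ⟩
  (1P +P constP (+ k)) *P (w′ *P (xx² *P wᵏ))           ≈⟨ *P-cong (≋-sym (constP-suc k)) (≋-refl {w′ *P (xx² *P wᵏ)}) ⟩
  constP (+ suc k) *P (w′ *P (xx² *P wᵏ))               ∎
  where
    open ≋-Reasoning
    wᵏ : Poly
    wᵏ = xx² ^P k

-- How θ acts on the polynomial coefficient in  g·w^k·D^k : the new
-- coefficient of w^k is  θ g + k·w′·g.
θ-twist : ℕ → Poly → Poly
θ-twist k g = θ g +P (constP (+ k) *P (w′ *P g))

θ-twist-cong : ∀ k {g h} → g ≋ h → θ-twist k g ≋ θ-twist k h
θ-twist-cong k e = +P-cong (θ-cong e) (*P-cong (≋-refl {constP (+ k)}) (*P-cong (≋-refl {w′}) e))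

θ-twist-vanish : ∀ k {g} → g ≋ [] → θ-twist k g ≋ []
θ-twist-vanish k e = ≋-trans (θ-twist-cong k e)
  (+P-cong (*P-zeroʳ xx²) (≋-trans (*P-cong (≋-refl {constP (+ k)}) (*P-zeroʳ w′)) (*P-zeroʳ (constP (+ k)))))

term : Poly → ℕ → Poly → Poly
term g k p = (g *P (xx² ^P k)) *P iter D k p

term-cong : ∀ {g h} k p → g ≋ h → term g k p ≋ term h k p
term-cong k p e = *P-cong (*P-cong e (≋-refl {xx² ^P k})) (≋-refl {iter D k p})

term-+ : ∀ g h k p → term (g +P h) k p ≋ (term g k p +P term h k p)
term-+ g h k p = ≋-trans (*P-cong (*P-distribʳ (xx² ^P k) g h) (≋-refl {iter D k p}))
                         (*P-distribʳ (iter D k p) (g *P (xx² ^P k)) (h *P (xx² ^P k)))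

θ-term : ∀ g k p → θ (term g k p) ≋ (term (θ-twist k g) k p +P term g (suc k) p)
θ-term g k p = begin
  θ ((g *P wᵏ) *P E)
    ≈⟨ θ-leibniz (g *P wᵏ) E ⟩
  (θ (g *P wᵏ) *P E) +P ((g *P wᵏ) *P θ E)
    ≈⟨ +P-cong (*P-cong (θ-leibniz g wᵏ) (≋-refl {E})) (≋-refl {(g *P wᵏ) *P θ E}) ⟩
  (((θ g *P wᵏ) +P (g *P θ wᵏ)) *P E) +P ((g *P wᵏ) *P θ E)
    ≈⟨ +P-cong (*P-cong (+P-cong (≋-refl {θ g *P wᵏ}) (*P-cong (≋-refl {g}) (θ-power k))) (≋-refl {E}))
               (≋-refl {(g *P wᵏ) *P θ E}) ⟩
  (((θ g *P wᵏ) +P (g *P (c *P (w′ *P wᵏ)))) *P E) +P ((g *P wᵏ) *P (xx² *P D E))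
    ≈⟨ solve 8 (λ θg g′ y c′ w₁ w e de →
                  ((θg ⊗ y ⊕ g′ ⊗ (c′ ⊗ (w₁ ⊗ y))) ⊗ e ⊕ (g′ ⊗ y) ⊗ (w ⊗ de))
                  ⊜ (((θg ⊕ c′ ⊗ (w₁ ⊗ g′)) ⊗ y) ⊗ e ⊕ (g′ ⊗ (w ⊗ y)) ⊗ de))
             ≋-refl (θ g) g wᵏ c w′ xx² E (D E) ⟩
  term (θ-twist k g) k p +P term g (suc k) p ∎
  where
    open ≋-Reasoning
    wᵏ E c : Poly
    wᵏ = xx² ^P k
    E  = iter D k p
    c  = constP (+ k)

-- Sums Σ_{k=0}^{n} f k; including k = 0 lets the index shift in θ-expand
-- be stated without side conditions.
Σ₀ : ℕ → (ℕ → Poly) → Poly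
Σ₀ zero    f = f 0
Σ₀ (suc n) f = Σ₀ n f +P f (suc n)

Σ₀-cong : ∀ n {f g} → (∀ k → f k ≋ g k) → Σ₀ n f ≋ Σ₀ n g
Σ₀-cong zero    e = e 0
Σ₀-cong (suc n) e = +P-cong (Σ₀-cong n e) (e (suc n))

Σ₀-+ : ∀ n f g → Σ₀ n (λ k → f k +P g k) ≋ (Σ₀ n f +P Σ₀ n g)
Σ₀-+ zero    f g = ≋-refl
Σ₀-+ (suc n) f g =
  ≋-trans (+P-cong (Σ₀-+ n f g) (≋-refl {f (suc n) +P g (suc n)}))
          (solve 4 (λ a b c d → ((a ⊕ b) ⊕ (c ⊕ d)) ⊜ ((a ⊕ c) ⊕ (b ⊕ d)))
                 ≋-refl (Σ₀ n f) (Σ₀ n g) (f (suc n)) (g (suc n)))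

θ-Σ₀ : ∀ n f → θ (Σ₀ n f) ≋ Σ₀ n (λ k → θ (f k))
θ-Σ₀ zero    f = ≋-refl
θ-Σ₀ (suc n) f = ≋-trans (θ-+ (Σ₀ n f) (f (suc n))) (+P-cong (θ-Σ₀ n f) (≋-refl {θ (f (suc n))}))

lower : (ℕ → Poly) → ℕ → Poly
lower f zero    = []
lower f (suc k) = f k

Σ₀-lower : ∀ n f → Σ₀ (suc n) (lower f) ≋ Σ₀ n f
Σ₀-lower zero    f = ≋-refl
Σ₀-lower (suc n) f = +P-cong (Σ₀-lower n f) (≋-refl {f (suc n)})

Σ₀-split : ∀ n f → Σ₀ n f ≋ (f 0 +P Σ₁ n f)
Σ₀-split zero    f = ≋-sym (+P-identityʳ (f 0))
Σ₀-split (suc n) f = ≋-trans (+P-cong (Σ₀-split n f) (≋-refl {f (suc n)})) (+P-assoc (f 0) (Σ₁ n f) (f (suc n)))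

expand : ℕ → (ℕ → Poly) → Poly → Poly
expand n g p = Σ₀ n (λ k → term (g k) k p)

next : (ℕ → Poly) → ℕ → Poly
next g k = θ-twist k (g k) +P lower g k

-- θ ∘ Σ_{k≤n} g_k w^k D^k = Σ_{k≤n+1} g′_k w^k D^k, provided g_(n+1) = 0
-- (so that the term θ-twist (n+1) g_(n+1) appearing at the top vanishes).
θ-expand : ∀ n g p → g (suc n) ≋ [] → θ (expand n g p) ≋ expand (suc n) (next g) p
θ-expand n g p top = begin
  θ (Σ₀ n T)                                  ≈⟨ θ-Σ₀ n T ⟩
  Σ₀ n (λ k → θ (T k))                        ≈⟨ Σ₀-cong n (λ k → θ-term (g k) k p) ⟩
  Σ₀ n (λ k → A k +P B k)                     ≈⟨ Σ₀-+ n A B ⟩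
  Σ₀ n A +P Σ₀ n B                            ≈⟨ +P-cong (≋-sym A-top) (≋-sym (Σ₀-lower n B)) ⟩
  Σ₀ (suc n) A +P Σ₀ (suc n) (lower B)        ≈⟨ ≋-sym (Σ₀-+ (suc n) A (lower B)) ⟩
  Σ₀ (suc n) (λ k → A k +P lower B k)         ≈⟨ Σ₀-cong (suc n) new-term ⟨
  Σ₀ (suc n) (λ k → term (next g k) k p)      ∎
  where
    open ≋-Reasoning
    T A B : ℕ → Poly
    T k = term (g k) k p
    A k = term (θ-twist k (g k)) k p
    B k = term (g k) (suc k) p
    A-top : (Σ₀ n A +P A (suc n)) ≋ Σ₀ n A
    A-top = ≋-trans (+P-cong (≋-refl {Σ₀ n A}) (term-cong (suc n) p (θ-twist-vanish (suc n) top)))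
                    (+P-identityʳ (Σ₀ n A))
    new-term : ∀ k → term (next g k) k p ≋ (A k +P lower B k)
    new-term zero    = term-+ (θ-twist 0 (g 0)) [] 0 p
    new-term (suc k) = term-+ (θ-twist (suc k) (g (suc k))) (g k) (suc k) p

-- The coefficients of θ^(m+1):  expansionCoeffs m k = G_(m+1,k),
-- starting from θ = 1·w·D.
expansionCoeffs : ℕ → ℕ → Poly
expansionCoeffs zero    (suc zero) = 1P
expansionCoeffs zero    _          = []
expansionCoeffs (suc m) k          = next (expansionCoeffs m) k

expansionCoeffs-zero : ∀ m → expansionCoeffs m 0 ≋ []
expansionCoeffs-zero zero    = ≋-refl
expansionCoeffs-zero (suc m) =
  ≋-trans (+P-identityʳ (θ-twist 0 (expansionCoeffs m 0))) (θ-twist-vanish 0 (expansionCoeffs-zero m))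

expansionCoeffs-vanish : ∀ m k → suc m < k → expansionCoeffs m k ≋ []
expansionCoeffs-vanish zero    (suc (suc k)) _         = ≋-refl
expansionCoeffs-vanish zero    (suc zero)    (s≤s ())
expansionCoeffs-vanish (suc m) (suc k)       (s≤s m<k) =
  +P-cong (θ-twist-vanish (suc k) (expansionCoeffs-vanish m (suc k) (ℕP.m<n⇒m<1+n m<k)))
          (expansionCoeffs-vanish m k m<k)

θ-iterate : ∀ m p → iter θ (suc m) p ≋ expand (suc m) (expansionCoeffs m) p
θ-iterate zero    p = solve 2 (λ w d → (w ⊗ d) ⊜ ((Κ 1P ⊗ (w ⊗ Κ 1P)) ⊗ d)) ≋-refl xx² (D p)
θ-iterate (suc m) p =
  ≋-trans (θ-cong (θ-iterate m p))
          (θ-expand (suc m) (expansionCoeffs m) p (expansionCoeffs-vanish m (suc (suc m)) ℕP.≤-refl))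

expansion : IsExpansion (λ n → expansionCoeffs (n ∸ 1))
expansion (suc m) _ p = get (begin
  iter θ (suc m) p                   ≈⟨ θ-iterate m p ⟩
  expand (suc m) (expansionCoeffs m) p
                                     ≈⟨ Σ₀-split (suc m) T ⟩
  T 0 +P Σ₁ (suc m) T                ≈⟨ +P-cong (term-cong 0 p (expansionCoeffs-zero m)) (≋-refl {Σ₁ (suc m) T}) ⟩
  Σ₁ (suc m) T                       ∎)
  where
    open ≋-Reasoning
    T : ℕ → Poly
    T k = term (expansionCoeffs m k) k p

xx²*P : ∀ q → (xx² *P q) ≋ (+ 0 ∷ (q +P (+ 0 ∷ q)))
xx²*P q = +P-cong (scale-zero q) (∷-cong (+ 0) (+P-cong (scale-one q) (∷-cong (+ 0) (*P-identityˡ q))))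

coeff-xx²*P : ∀ q i → coeff (xx² *P q) (suc i) ≡ coeff q i +ℤ coeff (+ 0 ∷ q) i
coeff-xx²*P q i = trans (get (xx²*P q) (suc i)) (coeff-+ q (+ 0 ∷ q) i)

-- w is not a zero divisor: the coefficients of g are recovered from those
-- of w·g one at a time.
xx²-cancel : ∀ {g h} → (xx² *P g) ≋ (xx² *P h) → g ≋ h
xx²-cancel {g} {h} (mk e) = mk agree
  where
    step : ∀ i → coeff g i +ℤ coeff (+ 0 ∷ g) i ≡ coeff h i +ℤ coeff (+ 0 ∷ h) i
    step i = trans (sym (coeff-xx²*P g i)) (trans (e (suc i)) (coeff-xx²*P h i))
    agree : ∀ i → coeff g i ≡ coeff h i
    agree zero    = trans (sym (ℤP.+-identityʳ _)) (trans (step 0) (ℤP.+-identityʳ _))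
    agree (suc i) = ∙-cancelʳ (coeff g i) (coeff g (suc i)) (coeff h (suc i))
                      (trans (step (suc i)) (cong (coeff h (suc i) +ℤ_) (sym (agree i))))

D²-x : ∀ k → iter D (suc (suc k)) xP ≡ []
D²-x zero    = refl
D²-x (suc k) = cong D (D²-x k)

Σ₁-single : ∀ m f → (∀ k → f (suc (suc k)) ≋ []) → Σ₁ (suc m) f ≋ f 1
Σ₁-single zero    f higher = ≋-refl
Σ₁-single (suc m) f higher =
  ≋-trans (+P-cong (Σ₁-single m f higher) (higher m)) (+P-identityʳ (f 1))

surj : ℕ → ℕ → ℕ
surj n k = k ! * S n k

surj-rec : ∀ n k → surj (suc n) (suc k) ≡ suc k * (surj n (suc k) +ℕ surj n k)
surj-rec n k = rearrange (suc k) (k !) (S n (suc k)) (S n k)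
  where rearrange : ∀ s f a c → (s * f) * (s * a +ℕ c) ≡ s * ((s * f) * a +ℕ f * c)
        rearrange = ℕSolver.solve-∀

surj-one : ∀ i → surj 1 (suc (suc i)) ≡ 0
surj-one i = trans (cong (suc (suc i) ! *_) (trans (ℕP.+-identityʳ _) (ℕP.*-zeroʳ (suc (suc i)))))
                   (ℕP.*-zeroʳ (suc (suc i) !))

module Values (G : ℕ → ℕ → Poly) (isExpansion : IsExpansion G) where

  -- θ^(m+1) x = w·G_(m+1,1), because D x = 1 and D^k x = 0 for k ≥ 2.
  θ-iterate-x : ∀ m → iter θ (suc m) xP ≋ (xx² *P G (suc m) 1)
  θ-iterate-x m =
    ≋-trans (mk (isExpansion (suc m) (s≤s z≤n) xP))
    (≋-trans (Σ₁-single m f higher)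
             (solve 2 (λ w g → ((g ⊗ (w ⊗ Κ 1P)) ⊗ Κ 1P) ⊜ (w ⊗ g)) ≋-refl xx² (G (suc m) 1)))
    where
      f : ℕ → Poly
      f k = G (suc m) k *P (xx² ^P k) *P iter D k xP
      higher : ∀ k → f (suc (suc k)) ≋ []
      higher k rewrite D²-x k = *P-zeroʳ (G (suc m) (suc (suc k)) *P (xx² ^P suc (suc k)))

  -- G_(1,1) = 1 and G_(n+1,1) = D(w·G_(n,1)), after cancelling w.
  G₁-base : G 1 1 ≋ 1P
  G₁-base = xx²-cancel (≋-sym (θ-iterate-x 0))

  G₁-step : ∀ m → G (suc (suc m)) 1 ≋ D (xx² *P G (suc m) 1)
  G₁-step m = xx²-cancel (≋-trans (≋-sym (θ-iterate-x (suc m))) (θ-cong (θ-iterate-x m)))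

  -- Stated for x·G_(n,1) so that the index k = 0 needs no special case.
  G₁-values : ∀ m k → coeff (+ 0 ∷ G (suc m) 1) k ≡ + surj (suc m) k
  G₁-values m       zero    = refl
  G₁-values zero    (suc i) = trans (get G₁-base i) (base i)
    where base : ∀ i → coeff 1P i ≡ + surj 1 (suc i)
          base zero    = refl
          base (suc i) = cong +_ (sym (surj-one i))
  G₁-values (suc m) (suc i) = begin
    coeff (G (suc (suc m)) 1) i                            ≡⟨ get (G₁-step m) i ⟩
    coeff (D (xx² *P g)) i                                 ≡⟨ coeff-D (xx² *P g) i ⟩
    + suc i *ℤ coeff (xx² *P g) (suc i)                    ≡⟨ cong (+ suc i *ℤ_) (coeff-xx²*P g i) ⟩
    + suc i *ℤ (coeff g i +ℤ coeff (+ 0 ∷ g) i)            ≡⟨ cong (+ suc i *ℤ_) (cong₂ _+ℤ_ (G₁-values m (suc i)) (G₁-values m i)) ⟩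
    + suc i *ℤ (+ surj n (suc i) +ℤ + surj n i)            ≡⟨ cong (+ suc i *ℤ_) (ℤP.pos-+ (surj n (suc i)) (surj n i)) ⟨
    + suc i *ℤ + (surj n (suc i) +ℕ surj n i)              ≡⟨ ℤP.pos-* (suc i) (surj n (suc i) +ℕ surj n i) ⟨
    + (suc i * (surj n (suc i) +ℕ surj n i))               ≡⟨ cong +_ (surj-rec n i) ⟨
    + surj (suc n) (suc i)                                 ∎
    where
      open ≡-Reasoning
      n : ℕ
      n = suc m
      g : Poly
      g = G n 1

  coefficients : ∀ n k → 1 ≤ k → k ≤ n → coeff (G n 1) (k ∸ 1) ≡ + (k ! * S n k)
  coefficients (suc m) (suc j) _ _  = G₁-values m (suc j)
  coefficients zero    (suc j) _ ()

mainTheorem5 : (∃ λ (G : ℕ → ℕ → Poly) → IsExpansion G)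
    × (∀ (G : ℕ → ℕ → Poly) → IsExpansion G →
         ∀ n k → 1 ≤ k → k ≤ n → coeff (G n 1) (k ∸ 1) ≡ + (k ! * S n k))
mainTheorem5 = ((λ n → expansionCoeffs (n ∸ 1)) , expansion) , Values.coefficients
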